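{- For every finite graph $G$ there exist two disjoint sets of vertices $U,W\subseteq V(G)$ with $|U|=|W|$, such that there are no edges of $G$ between $U$ and $W$, and the induced graph $G\setminus (U\cup W)$ has a Hamiltonian path.
   Context: $G\setminus (U\cup W)$ denotes the subgraph of $G$ induced on $V(G)\setminus(U\cup W)$; a Hamiltonian path is a path visiting every vertex of this graph exactly once (the empty path if the vertex set is empty). -}

module Defs where

open import Level using (Level; _⊔_; suc)
open import Data.Nat using (ℕ)
open import Data.Fin using (Fin)
open import Data.Fin.Subset using (Subset; _∈_; _∉_; ∣_∣)
open import Data.List using (List; []; _∷_)
open import Data.List.Relation.Unary.Unique.Propositional using (Unique)
import Data.List.Membership.Propositional as LM
open import Data.Product using (_×_)
open import Data.Empty using (⊥)
open import Relation.Nullary using (¬_)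
open import Relation.Binary using (Rel; Symmetric; Irreflexive; Decidable)
open import Relation.Binary.PropositionalEquality using (_≡_)

record Graph (n : ℕ) : Set₁ where
  field
    Adj     : Rel (Fin n) Level.zero
    sym     : Symmetric Adj
    irrefl  : Irreflexive _≡_ Adj
    adj?    : Decidable Adj
open Graph public

NoEdgesBetween : ∀ {n} → Graph n → Subset n → Subset n → Set
NoEdgesBetween G U W = ∀ u w → u ∈ U → w ∈ W → ¬ Adj G u w

Disjoint : ∀ {n} → Subset n → Subset n → Set
Disjoint U W = ∀ v → v ∈ U → v ∈ W → ⊥

data IsWalk {n : ℕ} (G : Graph n) : List (Fin n) → Set where
  []  : IsWalk G []
  [_] : ∀ v → IsWalk G (v ∷ [])
  _∷_ : ∀ {u v vs} → Adj G u v → IsWalk G (v ∷ vs) → IsWalk G (u ∷ v ∷ vs)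

-- A Hamiltonian path of the induced subgraph G \ (U ∪ W):
-- a path in G (no repeated vertices, consecutive vertices adjacent)
-- whose vertex set is exactly V(G) \ (U ∪ W).
-- (Induced subgraph: edges between its vertices are exactly those of G.)
IsHamPathAvoiding : ∀ {n} → Graph n → Subset n → Subset n → List (Fin n) → Set
IsHamPathAvoiding G U W p =
  Unique p × IsWalk G p ×
  (∀ v → (v LM.∈ p) → (v ∉ U × v ∉ W)) ×
  (∀ v → v ∉ U → v ∉ W → v LM.∈ p)

-- Run a depth-first search that keeps a stack p (a path, top vertex first), a set W of
-- unvisited vertices and a set U of retired ones. In each step, push an unvisited
-- neighbour of the top of p onto p (any unvisited vertex if p is empty), or, if the top
-- has no unvisited neighbour, retire it into U. A vertex is retired only when it has no
-- neighbour in W, and W only shrinks, so U and W stay non-adjacent; the path p always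
-- consists of the remaining vertices. Every step lowers |W| - |U| by exactly one,
-- starting from n, so after n steps |U| = |W|.
module Submission where

open import Defs
open import Data.Nat using (ℕ; zero; suc; _+_)
open import Data.Nat.Properties using (+-suc; +-identityʳ; suc-injective; 0≢1+n)
open import Data.Fin using (Fin; zero; suc)
open import Data.Fin.Properties using (_≟_; any?)
open import Data.Fin.Subset
  using (Subset; Nonempty; ∣_∣; _∈_; _∉_; ⊥; ⊤; inside; outside; ⁅_⁆; _∪_; _─_; _-_)
open import Data.Fin.Subset.Properties
  using ( _∈?_; ∉⊥; ∈⊤; nonempty?; Empty-unique; ∣⊥∣≡0; ∣⊤∣≡n; x∈⁅x⁆; x∈⁅y⁆⇒x≡y
        ; x∈p∪q⁺; x∈p∪q⁻; ∪-identityˡ; p─⊥≡p; p─q⊆p; x∈p∧x≢y⇒x∈p-y)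
open import Data.Vec using (_∷_; here; there)
open import Data.List using (List; []; _∷_)
open import Data.List.Membership.Propositional using () renaming (_∈_ to _∈ᴸ_; _∉_ to _∉ᴸ_)
import Data.List.Relation.Unary.Any as List
open import Data.List.Relation.Unary.All using (lookup)
open import Data.List.Relation.Unary.All.Properties using (¬Any⇒All¬)
open import Data.List.Relation.Unary.AllPairs using ([]; _∷_)
open import Data.List.Relation.Unary.Unique.Propositional using (Unique)
open import Data.Product using (_×_; ∃-syntax; _,_)
open import Data.Sum using (_⊎_; inj₁; inj₂; map₁)
import Data.Empty as Empty
open import Function using (_∘_)
open import Relation.Nullary using (¬_; yes; no)
open import Relation.Nullary.Decidable using (_×-dec_)
open import Relation.Binary.PropositionalEquality
  using (_≡_; _≢_; refl; trans; cong; module ≡-Reasoning)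
  renaming (sym to ≡-sym)

private
  variable
    n : ℕ

x∈p─q⇒x∉q : ∀ {x : Fin n} {p q} → x ∈ p ─ q → x ∉ q
x∈p─q⇒x∉q {p = _ ∷ _} ()          here
x∈p─q⇒x∉q {p = _ ∷ _} (there x∈) (there x∈q) = x∈p─q⇒x∉q x∈ x∈q

x∈p-y⇒x≢y : ∀ {x y : Fin n} {p} → x ∈ p - y → x ≢ y
x∈p-y⇒x≢y {y = y} x∈ refl = x∈p─q⇒x∉q x∈ (x∈⁅x⁆ y)

x∈p⇒∣p∣≡1+∣p-x∣ : ∀ {x : Fin n} {p} → x ∈ p → ∣ p ∣ ≡ suc ∣ p - x ∣
x∈p⇒∣p∣≡1+∣p-x∣ {p = inside ∷ p}  here       = cong (suc ∘ ∣_∣) (≡-sym (p─⊥≡p p))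
x∈p⇒∣p∣≡1+∣p-x∣ {p = inside ∷ _}  (there x∈) = cong suc (x∈p⇒∣p∣≡1+∣p-x∣ x∈)
x∈p⇒∣p∣≡1+∣p-x∣ {p = outside ∷ _} (there x∈) = x∈p⇒∣p∣≡1+∣p-x∣ x∈

x∉p⇒∣⁅x⁆∪p∣≡1+∣p∣ : ∀ {x : Fin n} {p} → x ∉ p → ∣ ⁅ x ⁆ ∪ p ∣ ≡ suc ∣ p ∣
x∉p⇒∣⁅x⁆∪p∣≡1+∣p∣ {x = zero}  {inside ∷ _}  x∉ = Empty.⊥-elim (x∉ here)
x∉p⇒∣⁅x⁆∪p∣≡1+∣p∣ {x = zero}  {outside ∷ p} x∉ = cong (suc ∘ ∣_∣) (∪-identityˡ p)
x∉p⇒∣⁅x⁆∪p∣≡1+∣p∣ {x = suc _} {inside ∷ _}  x∉ = cong suc (x∉p⇒∣⁅x⁆∪p∣≡1+∣p∣ (x∉ ∘ there))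
x∉p⇒∣⁅x⁆∪p∣≡1+∣p∣ {x = suc _} {outside ∷ _} x∉ = x∉p⇒∣⁅x⁆∪p∣≡1+∣p∣ (x∉ ∘ there)

surplus-visit : ∀ (U : Subset n) {W : Subset n} {w k} → w ∈ W →
                ∣ U ∣ + suc k ≡ ∣ W ∣ → ∣ U ∣ + k ≡ ∣ W - w ∣
surplus-visit U {W} {w} {k} w∈W surplus = suc-injective (begin
  suc (∣ U ∣ + k)  ≡⟨ +-suc ∣ U ∣ k ⟨
  ∣ U ∣ + suc k    ≡⟨ surplus ⟩
  ∣ W ∣            ≡⟨ x∈p⇒∣p∣≡1+∣p-x∣ w∈W ⟩
  suc ∣ W - w ∣    ∎)
  where open ≡-Reasoning

surplus-retire : ∀ {U : Subset n} (W : Subset n) {v k} → v ∉ U →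
                 ∣ U ∣ + suc k ≡ ∣ W ∣ → ∣ ⁅ v ⁆ ∪ U ∣ + k ≡ ∣ W ∣
surplus-retire {U = U} W {v} {k} v∉U surplus = begin
  ∣ ⁅ v ⁆ ∪ U ∣ + k  ≡⟨ cong (_+ k) (x∉p⇒∣⁅x⁆∪p∣≡1+∣p∣ v∉U) ⟩
  suc ∣ U ∣ + k      ≡⟨ +-suc ∣ U ∣ k ⟨
  ∣ U ∣ + suc k      ≡⟨ surplus ⟩
  ∣ W ∣              ∎
  where open ≡-Reasoning

surplus⇒nonempty : ∀ (U : Subset n) {W : Subset n} {k} → ∣ U ∣ + suc k ≡ ∣ W ∣ → Nonempty W
surplus⇒nonempty {n} U {W} {k} surplus with nonempty? W
... | yes W≢∅ = W≢∅
... | no  W≡∅ = Empty.⊥-elim (0≢1+n (begin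
  0                ≡⟨ ∣⊥∣≡0 n ⟨
  ∣ ⊥ {n} ∣        ≡⟨ cong ∣_∣ (Empty-unique W≡∅) ⟨
  ∣ W ∣            ≡⟨ surplus ⟨
  ∣ U ∣ + suc k    ≡⟨ +-suc ∣ U ∣ k ⟩
  suc (∣ U ∣ + k)  ∎))
  where open ≡-Reasoning

Unique-tail : ∀ {v : Fin n} {p} → Unique (v ∷ p) → Unique p
Unique-tail (_ ∷ p) = p

IsWalk-tail : ∀ {G : Graph n} {v p} → IsWalk G (v ∷ p) → IsWalk G p
IsWalk-tail [ _ ]   = []
IsWalk-tail (_ ∷ p) = p

record SearchState (G : Graph n) (U : Subset n) (p : List (Fin n)) (W : Subset n) : Set where
  field
    cover   : ∀ v → v ∈ U ⊎ v ∈ᴸ p ⊎ v ∈ W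
    U#W     : Disjoint U W
    U#p     : ∀ v → v ∈ U → v ∉ᴸ p
    p#W     : ∀ v → v ∈ᴸ p → v ∉ W
    unique  : Unique p
    walk    : IsWalk G p
    noEdges : NoEdgesBetween G U W

module _ {n : ℕ} {G : Graph n} where

  visit : ∀ {U p W w} → SearchState G U p W → w ∈ W → IsWalk G (w ∷ p) →
          SearchState G U (w ∷ p) (W - w)
  visit {U} {p} {W} {w} s w∈W w∷p = record
    { cover   = cover′
    ; U#W     = λ v v∈U → U#W v v∈U ∘ p─q⊆p W _
    ; U#p     = U#p′
    ; p#W     = p#W′
    ; unique  = ¬Any⇒All¬ p (λ w∈p → p#W w w∈p w∈W) ∷ unique
    ; walk    = w∷p
    ; noEdges = λ u v u∈U → noEdges u v u∈U ∘ p─q⊆p W _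
    }
    where
    open SearchState s
    cover′ : ∀ v → v ∈ U ⊎ v ∈ᴸ w ∷ p ⊎ v ∈ W - w
    cover′ v with cover v
    ... | inj₁ v∈U         = inj₁ v∈U
    ... | inj₂ (inj₁ v∈p) = inj₂ (inj₁ (List.there v∈p))
    ... | inj₂ (inj₂ v∈W) with v ≟ w
    ...   | yes v≡w = inj₂ (inj₁ (List.here v≡w))
    ...   | no  v≢w = inj₂ (inj₂ (x∈p∧x≢y⇒x∈p-y v∈W v≢w))
    U#p′ : ∀ v → v ∈ U → v ∉ᴸ w ∷ p
    U#p′ v v∈U (List.here refl)  = U#W v v∈U w∈W
    U#p′ v v∈U (List.there v∈p) = U#p v v∈U v∈p
    p#W′ : ∀ v → v ∈ᴸ w ∷ p → v ∉ W - w
    p#W′ v (List.here v≡w)  v∈W-w = x∈p-y⇒x≢y v∈W-w v≡w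
    p#W′ v (List.there v∈p) v∈W-w = p#W v v∈p (p─q⊆p W _ v∈W-w)

  retire : ∀ {U v p W} → SearchState G U (v ∷ p) W → (∀ w → w ∈ W → ¬ Adj G v w) →
           SearchState G (⁅ v ⁆ ∪ U) p W
  retire {U} {v} {p} {W} s v↛W = record
    { cover   = cover′
    ; U#W     = U#W′
    ; U#p     = U#p′
    ; p#W     = λ u → p#W u ∘ List.there
    ; unique  = Unique-tail unique
    ; walk    = IsWalk-tail walk
    ; noEdges = noEdges′
    }
    where
    open SearchState s
    cover′ : ∀ u → u ∈ ⁅ v ⁆ ∪ U ⊎ u ∈ᴸ p ⊎ u ∈ W
    cover′ u with cover u
    ... | inj₁ u∈U                     = inj₁ (x∈p∪q⁺ (inj₂ u∈U))
    ... | inj₂ (inj₁ (List.here refl)) = inj₁ (x∈p∪q⁺ (inj₁ (x∈⁅x⁆ v)))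
    ... | inj₂ (inj₁ (List.there u∈p)) = inj₂ (inj₁ u∈p)
    ... | inj₂ (inj₂ u∈W)              = inj₂ (inj₂ u∈W)
    split : ∀ {u} → u ∈ ⁅ v ⁆ ∪ U → u ≡ v ⊎ u ∈ U
    split u∈ = map₁ (x∈⁅y⁆⇒x≡y v) (x∈p∪q⁻ ⁅ v ⁆ U u∈)
    U#W′ : Disjoint (⁅ v ⁆ ∪ U) W
    U#W′ u u∈ with split u∈
    ... | inj₁ refl = p#W v (List.here refl)
    ... | inj₂ u∈U  = U#W u u∈U
    U#p′ : ∀ u → u ∈ ⁅ v ⁆ ∪ U → u ∉ᴸ p
    U#p′ u u∈ u∈p with split u∈ | unique
    ... | inj₁ refl | v∉p ∷ _ = lookup v∉p u∈p refl
    ... | inj₂ u∈U  | _       = U#p u u∈U (List.there u∈p)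
    noEdges′ : NoEdgesBetween G (⁅ v ⁆ ∪ U) W
    noEdges′ u w u∈ with split u∈
    ... | inj₁ refl = v↛W w
    ... | inj₂ u∈U  = noEdges u w u∈U

  isHamPathAvoiding : ∀ {U p W} → SearchState G U p W → IsHamPathAvoiding G U W p
  isHamPathAvoiding {U} {p} {W} s =
    unique , walk , (λ v v∈p → (λ v∈U → U#p v v∈U v∈p) , p#W v v∈p) , onPath
    where
    open SearchState s
    onPath : ∀ v → v ∉ U → v ∉ W → v ∈ᴸ p
    onPath v v∉U v∉W with cover v
    ... | inj₁ v∈U        = Empty.⊥-elim (v∉U v∈U)
    ... | inj₂ (inj₁ v∈p) = v∈p
    ... | inj₂ (inj₂ v∈W) = Empty.⊥-elim (v∉W v∈W)

  StateWithSurplus : ℕ → Set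
  StateWithSurplus k = ∃[ U ] ∃[ p ] ∃[ W ] (SearchState G U p W × ∣ U ∣ + k ≡ ∣ W ∣)

  step : ∀ {k} → StateWithSurplus (suc k) → StateWithSurplus k
  step (U , [] , W , s , surplus) with surplus⇒nonempty U surplus
  ... | w , w∈W = U , w ∷ [] , W - w , visit s w∈W [ w ] , surplus-visit U w∈W surplus
  step (U , v ∷ p , W , s , surplus) with any? (λ w → (w ∈? W) ×-dec adj? G v w)
  ... | yes (w , w∈W , v~w) =
    U , w ∷ v ∷ p , W - w , visit s w∈W (Graph.sym G v~w ∷ SearchState.walk s) ,
    surplus-visit U w∈W surplus
  ... | no  v↛W =
    ⁅ v ⁆ ∪ U , p , W , retire s (λ w w∈W v~w → v↛W (w , w∈W , v~w)) ,
    surplus-retire W v∉U surplus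
    where
    v∉U : v ∉ U
    v∉U v∈U = SearchState.U#p s v v∈U (List.here refl)

  start : StateWithSurplus n
  start = ⊥ , [] , ⊤ , record
    { cover   = λ _ → inj₂ (inj₂ ∈⊤)
    ; U#W     = λ _ v∈⊥ _ → ∉⊥ v∈⊥
    ; U#p     = λ _ v∈⊥ _ → ∉⊥ v∈⊥
    ; p#W     = λ _ ()
    ; unique  = []
    ; walk    = []
    ; noEdges = λ _ _ u∈⊥ _ _ → ∉⊥ u∈⊥
    } , trans (cong (_+ n) (∣⊥∣≡0 n)) (≡-sym (∣⊤∣≡n n))

  run : ∀ k → StateWithSurplus k → StateWithSurplus 0
  run zero    s = s
  run (suc k) s = run k (step s)

lemma2p1 : (n : ℕ) (G : Graph n) →
    ∃[ U ] ∃[ W ] (Disjoint U W × ∣ U ∣ ≡ ∣ W ∣ × NoEdgesBetween G U W ×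
      ∃[ p ] IsHamPathAvoiding G U W p)
lemma2p1 n G with run n start
... | U , p , W , s , balanced =
  U , W , U#W , trans (≡-sym (+-identityʳ ∣ U ∣)) balanced , noEdges , p , isHamPathAvoiding s
  where open SearchState s
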